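{- Let $\mathbf C,\mathbf D$ be categories, $\mathbf C$ with finite coproducts, and let $\#\colon\mathbf C\times(\mathbf C\times\mathbf D)\to\mathbf C$ be a parametrized monad with unit $\eta$ and Kleisli lifting $(-)^*$, such that all final coalgebras below exist. Then $X\#^\nu Z=\nu\gamma.\,X\#(\gamma,Z)$ defines a parametrized monad $\#^\nu\colon\mathbf C\times\mathbf D\to\mathbf C$ (with unit $\eta^\nu$ and Kleisli lifting $(-)^\ddagger$ described below). Moreover: (1) If $\#$ is guarded, then so is $\#^\nu$, with guardedness defined by: $f\colon X\to Y\#^\nu Z$ is $\sigma$-guarded iff $\mathrm{out}\circ f\colon X\to Y\#(Y\#^\nu Z,Z)$ is $\sigma$-guarded; and the assignment $\#\mapsto\#^\nu$ extends to a functor between the respective categories of guarded parametrized monads, sending a parametrized guarded monad morphism $\alpha\colon\#\to\#'$ to $\alpha^\nu$ with components $\mathrm{coit}(\alpha\circ\mathrm{out})$. (2) If $\#$ is guarded pre-iterative with iteration operator $(-)^\dagger$, then so is $\#^\nu$, with iteration operator sending $f\colon X\to_{\mathrm{inr}}(Y+X)\#^\nu Z$ to $f^{\dagger\dagger}=\mathrm{coit}\big([\eta,(\mathrm{out}\circ f)^\dagger]^*\circ\mathrm{out}\big)\circ\eta^\nu\circ\mathrm{inr}\colon X\to Y\#^\nu Z$, where $\mathrm{out}\colon(Y+X)\#^\nu Z\to(Y+X)\#((Y+X)\#^\nu Z,Z)$ and the coiteration is taken for the coalgebra $[\eta,(\mathrm{out}\circ f)^\dagger]^*\circ\mathrm{out}\colon(Y+X)\#^\nu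 Z\to Y\#((Y+X)\#^\nu Z,Z)$ of the functor $\gamma\mapsto Y\#(\gamma,Z)$. (3) If $\#$ is guarded iterative, then so is $\#^\nu$, with solutions as in (2).
   Context: A parametrized monad is a bifunctor $\#\colon\mathbf C\times\mathbf E\to\mathbf C$ such that for each $P\in\mathbf E$, $(-)\#P$ is a monad on $\mathbf C$ and for each $p\colon P\to P'$, $\mathrm{id}\#p$ is (the component of) a monad morphism $(-)\#P\to(-)\#P'$. Summands: $\sigma\colon Y'\triangleleft Y$ is a pair of morphisms exhibiting $Y$ as a coproduct, $\bar\sigma$ its complement. A monad $M$ (unit $\eta$, lifting $(-)^*$) is guarded if equipped with a relation $f\colon X\to_\sigma MY$ ($\sigma$ a summand of $Y$) closed under (trv) $M(\mathrm{inl})\circ f\colon X\to_{\mathrm{inr}}M(Y+Z)$ for all $f\colon X\to MY$; (par) $f\colon X\to_\sigma MZ$, $g\colon Y\to_\sigma MZ$ imply $[f,g]\colon X+Y\to_\sigma MZ$; (cmp) $f\colon X\to_{\mathrm{inr}}M(Y+Z)$, $g\colon Y\to_\sigma MV$, $h\colon Z\to MV$ imply $[g,h]^*\circ f\colon X\to_\sigma MV$. A guarded monad morphism preserves guardedness. A parametrized guarded monad has each $(-)\#P$ guarded and each $\mathrm{id}\#p$ a guarded monad morphism; it is guarded pre-iterative if each $(-)\#P$ is guarded pre-iterative (equipped with solutions $f^\dagger$, $f^\dagger=[\eta,f^\dagger]^*\circ f$, for all $f\colon X\to_{\mathrm{inr}}(Y+X)\#P$) and $(\mathrm{id}\#p)\circ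 g^\dagger=((\mathrm{id}\#p)\circ g)^\dagger$; guarded iterative if moreover solutions are unique. A parametrized (guarded) monad morphism is a natural transformation whose components $\alpha_{ -,P}$ are (guarded) monad morphisms. Structure of $\#^\nu$ for fixed $Z$: write $\Gamma X=X\#^\nu Z$ with final coalgebra structure $\mathrm{out}\colon\Gamma X\to X\#(\Gamma X,Z)$ and coiteration $\mathrm{coit}$. The unit $\eta^\nu_X$ is the unique map with $\mathrm{out}\circ\eta^\nu_X=\eta_{X,(\Gamma X,Z)}$. For $f\colon X\to\Gamma Y$, $f^\ddagger\colon\Gamma X\to\Gamma Y$ is the unique map such that $[f^\ddagger,\mathrm{id}]$ is a coalgebra morphism from $(\Gamma X+\Gamma Y,[\hat f,(\mathrm{id}_Y\#(\mathrm{inr},\mathrm{id}_Z))\circ\mathrm{out}])$ to $(\Gamma Y,\mathrm{out})$ for the functor $\gamma\mapsto Y\#(\gamma,Z)$, where $\bar f=(\mathrm{id}_Y\#(\mathrm{inr},\mathrm{id}_Z))\circ\mathrm{out}\circ f$ and $\hat f=\bar f^*\circ(\mathrm{id}_X\#(\mathrm{inl},\mathrm{id}_Z))\circ\mathrm{out}$ (the lifting taken in the monad $(-)\#(\Gamma X+\Gamma Y,Z)$). The component of $\alpha^\nu$ at $(X,Z)$ is the unique coalgebra morphism $(X\#^\nu Z,\alpha\circ\mathrm{out})\to(X\#'^\nu Z,\mathrm{out}')$. -}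

module Defs where

open import Level using (Level; _⊔_) renaming (suc to lsuc)
open import Relation.Binary using (Rel; IsEquivalence)
open import Data.Product using (_×_; _,_; proj₁; proj₂)

record Category (o ℓ e : Level) : Set (lsuc (o ⊔ ℓ ⊔ e)) where
  infix 4 _≈_ _⇒_
  infixr 9 _∘_
  field
    Obj : Set o
    _⇒_ : Obj → Obj → Set ℓ
    _≈_ : ∀ {A B} → Rel (A ⇒ B) e
    id : ∀ {A} → A ⇒ A
    _∘_ : ∀ {A B C} → B ⇒ C → A ⇒ B → A ⇒ C
    equiv : ∀ {A B} → IsEquivalence (_≈_ {A} {B})
    assoc : ∀ {A B C D} {f : A ⇒ B} {g : B ⇒ C} {h : C ⇒ D} →
            (h ∘ g) ∘ f ≈ h ∘ (g ∘ f)
    identityˡ : ∀ {A B} {f : A ⇒ B} → id ∘ f ≈ f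
    identityʳ : ∀ {A B} {f : A ⇒ B} → f ∘ id ≈ f
    ∘-resp-≈ : ∀ {A B C} {f h : B ⇒ C} {g i : A ⇒ B} →
               f ≈ h → g ≈ i → f ∘ g ≈ h ∘ i

Product : ∀ {o ℓ e o' ℓ' e'} → Category o ℓ e → Category o' ℓ' e' →
          Category (o ⊔ o') (ℓ ⊔ ℓ') (e ⊔ e')
Product C D = record
  { Obj = C.Obj × D.Obj
  ; _⇒_ = λ A B → (proj₁ A C.⇒ proj₁ B) × (proj₂ A D.⇒ proj₂ B)
  ; _≈_ = λ f g → (proj₁ f C.≈ proj₁ g) × (proj₂ f D.≈ proj₂ g)
  ; id = C.id , D.id
  ; _∘_ = λ f g → (proj₁ f C.∘ proj₁ g) , (proj₂ f D.∘ proj₂ g)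
  ; equiv = record
      { refl = IsEquivalence.refl C.equiv , IsEquivalence.refl D.equiv
      ; sym = λ p → IsEquivalence.sym C.equiv (proj₁ p) , IsEquivalence.sym D.equiv (proj₂ p)
      ; trans = λ p q → IsEquivalence.trans C.equiv (proj₁ p) (proj₁ q)
                      , IsEquivalence.trans D.equiv (proj₂ p) (proj₂ q)
      }
  ; assoc = C.assoc , D.assoc
  ; identityˡ = C.identityˡ , D.identityˡ
  ; identityʳ = C.identityʳ , D.identityʳ
  ; ∘-resp-≈ = λ p q → C.∘-resp-≈ (proj₁ p) (proj₁ q) , D.∘-resp-≈ (proj₂ p) (proj₂ q)
  }
  where
  module C = Category C
  module D = Category D

record Coproducts {o ℓ e} (C : Category o ℓ e) : Set (o ⊔ ℓ ⊔ e) where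
  open Category C
  infixr 6 _+_
  field
    _+_ : Obj → Obj → Obj
    inl : ∀ {A B} → A ⇒ A + B
    inr : ∀ {A B} → B ⇒ A + B
    [_,_] : ∀ {A B W} → A ⇒ W → B ⇒ W → A + B ⇒ W
    inject₁ : ∀ {A B W} {f : A ⇒ W} {g : B ⇒ W} → [ f , g ] ∘ inl ≈ f
    inject₂ : ∀ {A B W} {f : A ⇒ W} {g : B ⇒ W} → [ f , g ] ∘ inr ≈ g
    unique : ∀ {A B W} {f : A ⇒ W} {g : B ⇒ W} {h : A + B ⇒ W} →
             h ∘ inl ≈ f → h ∘ inr ≈ g → [ f , g ] ≈ h
    𝟘 : Obj
    ¡ : ∀ {A} → 𝟘 ⇒ A
    ¡-unique : ∀ {A} (f : 𝟘 ⇒ A) → ¡ ≈ f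

module Over {o ℓ e} (C : Category o ℓ e) (cop : Coproducts C) where
  open Category C
  open Coproducts cop

  -- A summand σ : Y₁ ◁ Y : a pair of morphisms (σ, σ̄) exhibiting Y as a
  -- coproduct of Y₁ and Y₂ (σ̄ is the complement of σ).
  record Summand (Y : Obj) : Set (o ⊔ ℓ ⊔ e) where
    field
      Y₁ Y₂ : Obj
      σ : Y₁ ⇒ Y
      σ̄ : Y₂ ⇒ Y
      copair : ∀ {W} → Y₁ ⇒ W → Y₂ ⇒ W → Y ⇒ W
      copair-σ : ∀ {W} {f : Y₁ ⇒ W} {g : Y₂ ⇒ W} → copair f g ∘ σ ≈ f
      copair-σ̄ : ∀ {W} {f : Y₁ ⇒ W} {g : Y₂ ⇒ W} → copair f g ∘ σ̄ ≈ g
      copair-unique : ∀ {W} {f : Y₁ ⇒ W} {g : Y₂ ⇒ W} {h : Y ⇒ W} →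
                      h ∘ σ ≈ f → h ∘ σ̄ ≈ g → copair f g ≈ h

  inrS : ∀ {Y Z} → Summand (Y + Z)
  inrS {Y} {Z} = record
    { Y₁ = Z ; Y₂ = Y ; σ = inr ; σ̄ = inl
    ; copair = λ f g → [ g , f ]
    ; copair-σ = inject₂ ; copair-σ̄ = inject₁
    ; copair-unique = λ p q → unique q p
    }

  record FinalCoalgebra (G₀ : Obj → Obj)
                        (G₁ : ∀ {A B} → A ⇒ B → G₀ A ⇒ G₀ B) : Set (o ⊔ ℓ ⊔ e) where
    field
      ν : Obj
      out : ν ⇒ G₀ ν
      coit : ∀ {A} → A ⇒ G₀ A → A ⇒ ν
      coit-commutes : ∀ {A} (a : A ⇒ G₀ A) → out ∘ coit a ≈ G₁ (coit a) ∘ a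
      coit-unique : ∀ {A} (a : A ⇒ G₀ A) (h : A ⇒ ν) →
                    out ∘ h ≈ G₁ h ∘ a → h ≈ coit a

  -- Parametrized monads # : C × E → C, as bifunctors with, for each
  -- parameter P, a Kleisli triple (η P , lift P) on (-) # P.

  module _ {oE ℓE eE} (E : Category oE ℓE eE) where
    private module E = Category E

    record PMData : Set (o ⊔ ℓ ⊔ oE ⊔ ℓE) where
      field
        F₀ : Obj → E.Obj → Obj
        F₁ : ∀ {X X' P P'} → X ⇒ X' → P E.⇒ P' → F₀ X P ⇒ F₀ X' P'
        η : ∀ {X} P → X ⇒ F₀ X P
        lift : ∀ {X Y} P → X ⇒ F₀ Y P → F₀ X P ⇒ F₀ Y P

    record IsParametrizedMonad (d : PMData) : Set (o ⊔ ℓ ⊔ e ⊔ oE ⊔ ℓE ⊔ eE) where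
      open PMData d
      field
        F-identity : ∀ {X P} → F₁ (id {X}) (E.id {P}) ≈ id
        F-homomorphism : ∀ {X Y W P Q R} {f : X ⇒ Y} {g : Y ⇒ W}
                           {p : P E.⇒ Q} {q : Q E.⇒ R} →
                         F₁ (g ∘ f) (q E.∘ p) ≈ F₁ g q ∘ F₁ f p
        F-resp-≈ : ∀ {X Y P Q} {f f' : X ⇒ Y} {p p' : P E.⇒ Q} →
                   f ≈ f' → p E.≈ p' → F₁ f p ≈ F₁ f' p'
        lift-resp : ∀ {X Y} P {f g : X ⇒ F₀ Y P} → f ≈ g → lift P f ≈ lift P g
        lift-η : ∀ {X Y} P (f : X ⇒ F₀ Y P) → lift P f ∘ η P ≈ f
        η-lift : ∀ {X} P → lift P (η {X} P) ≈ id
        lift-assoc : ∀ {X Y W} P (f : X ⇒ F₀ Y P) (g : Y ⇒ F₀ W P) →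
                     lift P (lift P g ∘ f) ≈ lift P g ∘ lift P f
        F₁-lift : ∀ {X Y} P (f : X ⇒ Y) → F₁ f (E.id {P}) ≈ lift P (η P ∘ f)
        morph-η : ∀ {X P P'} (p : P E.⇒ P') → F₁ (id {X}) p ∘ η P ≈ η P'
        morph-lift : ∀ {X Y P P'} (p : P E.⇒ P') (f : X ⇒ F₀ Y P) →
                     F₁ id p ∘ lift P f ≈ lift P' (F₁ id p ∘ f) ∘ F₁ id p

    GuardData : (g : Level) → PMData → Set (o ⊔ ℓ ⊔ e ⊔ oE ⊔ lsuc g)
    GuardData g d = ∀ {X Y} P → Summand Y → X ⇒ PMData.F₀ d Y P → Set g

    record IsParametrizedGuarded {g} (d : PMData) (G : GuardData g d)
           : Set (o ⊔ ℓ ⊔ e ⊔ oE ⊔ ℓE ⊔ g) where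
      open PMData d
      field
        resp : ∀ {X Y P} {σ : Summand Y} {f f' : X ⇒ F₀ Y P} →
               f ≈ f' → G P σ f → G P σ f'
        trv : ∀ {X Y Z P} (f : X ⇒ F₀ Y P) →
              G P (inrS {Y} {Z}) (F₁ inl (E.id {P}) ∘ f)
        par : ∀ {X Y Z P} {σ : Summand Z} {f : X ⇒ F₀ Z P} {h : Y ⇒ F₀ Z P} →
              G P σ f → G P σ h → G P σ [ f , h ]
        cmp : ∀ {X Y Z V P} {σ : Summand V} (f : X ⇒ F₀ (Y + Z) P)
                (h₁ : Y ⇒ F₀ V P) (h₂ : Z ⇒ F₀ V P) →
              G P inrS f → G P σ h₁ → G P σ (lift P [ h₁ , h₂ ] ∘ f)
        preserve : ∀ {X Y P P'} (p : P E.⇒ P') {σ : Summand Y} (f : X ⇒ F₀ Y P) →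
                   G P σ f → G P' σ (F₁ id p ∘ f)

    IterData : ∀ {g} (d : PMData) → GuardData g d → Set (o ⊔ ℓ ⊔ oE ⊔ g)
    IterData d G = ∀ {X Y} P (f : X ⇒ PMData.F₀ d (Y + X) P) →
                   G P inrS f → X ⇒ PMData.F₀ d Y P

    record IsGuardedPreIterative {g} (d : PMData) (G : GuardData g d)
           (dag : IterData d G) : Set (o ⊔ ℓ ⊔ e ⊔ oE ⊔ ℓE ⊔ g) where
      open PMData d
      field
        isGuarded : IsParametrizedGuarded d G
        dag-resp : ∀ {X Y P} {f f' : X ⇒ F₀ (Y + X) P}
                     (q : G P inrS f) (q' : G P inrS f') →
                   f ≈ f' → dag P f q ≈ dag P f' q'
        fixpoint : ∀ {X Y P} (f : X ⇒ F₀ (Y + X) P) (q : G P inrS f) →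
                   dag P f q ≈ lift P [ η P , dag P f q ] ∘ f
        natural : ∀ {X Y P P'} (p : P E.⇒ P') (f : X ⇒ F₀ (Y + X) P)
                    (q : G P inrS f) (q' : G P' inrS (F₁ id p ∘ f)) →
                  F₁ id p ∘ dag P f q ≈ dag P' (F₁ id p ∘ f) q'

    record IsGuardedIterative {g} (d : PMData) (G : GuardData g d)
           (dag : IterData d G) : Set (o ⊔ ℓ ⊔ e ⊔ oE ⊔ ℓE ⊔ g) where
      open PMData d
      field
        isPreIterative : IsGuardedPreIterative d G dag
        unique-solution : ∀ {X Y P} (f : X ⇒ F₀ (Y + X) P) (q : G P inrS f)
                            (h : X ⇒ F₀ Y P) →
                          h ≈ lift P [ η P , h ] ∘ f → h ≈ dag P f q

    MorData : PMData → PMData → Set (o ⊔ ℓ ⊔ oE)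
    MorData d d' = ∀ {X} P → PMData.F₀ d X P ⇒ PMData.F₀ d' X P

    idMor : (d : PMData) → MorData d d
    idMor d P = id

    compMor : {d d' d'' : PMData} → MorData d' d'' → MorData d d' → MorData d d''
    compMor β α P = β P ∘ α P

    record IsParametrizedMonadMorphism (d d' : PMData) (α : MorData d d')
           : Set (o ⊔ ℓ ⊔ e ⊔ oE ⊔ ℓE) where
      private
        module d = PMData d
        module d' = PMData d'
      field
        natural : ∀ {X X' P P'} (f : X ⇒ X') (p : P E.⇒ P') →
                  α P' ∘ d.F₁ f p ≈ d'.F₁ f p ∘ α P
        α-η : ∀ {X} P → α P ∘ d.η {X} P ≈ d'.η P
        α-lift : ∀ {X Y} P (f : X ⇒ d.F₀ Y P) →
                 α P ∘ d.lift P f ≈ d'.lift P (α P ∘ f) ∘ α P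

    record IsParametrizedGuardedMonadMorphism {g} (d : PMData) (G : GuardData g d)
           (d' : PMData) (G' : GuardData g d') (α : MorData d d')
           : Set (o ⊔ ℓ ⊔ e ⊔ oE ⊔ ℓE ⊔ g) where
      field
        isMorphism : IsParametrizedMonadMorphism d d' α
        preserve : ∀ {X Y P} {σ : Summand Y} (f : X ⇒ PMData.F₀ d Y P) →
                   G P σ f → G' P σ (α P ∘ f)

module Theory {o ℓ e o' ℓ' e'} (C : Category o ℓ e) (D : Category o' ℓ' e')
              (cop : Coproducts C) where
  open Category C
  open Coproducts cop
  open Over C cop public
  private module D = Category D

  E : Category (o ⊔ o') (ℓ ⊔ ℓ') (e ⊔ e')
  E = Product C D

  Finals : PMData E → Set (o ⊔ ℓ ⊔ e ⊔ o')
  Finals d = (X : Obj) (Z : D.Obj) →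
             FinalCoalgebra (λ γ → F₀ X (γ , Z)) (λ h → F₁ id (h , D.id))
    where open PMData d

  module Nu (d : PMData E) (fin : Finals d) where
    open PMData d

    Γ : Obj → D.Obj → Obj
    Γ X Z = FinalCoalgebra.ν (fin X Z)

    out : ∀ X Z → Γ X Z ⇒ F₀ X (Γ X Z , Z)
    out X Z = FinalCoalgebra.out (fin X Z)

    coit : ∀ X Z {A} → A ⇒ F₀ X (A , Z) → A ⇒ Γ X Z
    coit X Z = FinalCoalgebra.coit (fin X Z)

    -- the inverse of out (Lambek): coit (id # (out , id))
    out⁻¹ : ∀ X Z → F₀ X (Γ X Z , Z) ⇒ Γ X Z
    out⁻¹ X Z = coit X Z (F₁ id (out X Z , D.id))

    ην : ∀ {X} Z → X ⇒ Γ X Z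
    ην {X} Z = out⁻¹ X Z ∘ η (Γ X Z , Z)

    ‡-coalg : ∀ {X Y} Z → X ⇒ Γ Y Z →
              Γ X Z + Γ Y Z ⇒ F₀ Y (Γ X Z + Γ Y Z , Z)
    ‡-coalg {X} {Y} Z f = [ f̂ , F₁ id (inr , D.id) ∘ out Y Z ]
      where
      f̄ : X ⇒ F₀ Y (Γ X Z + Γ Y Z , Z)
      f̄ = F₁ id (inr , D.id) ∘ out Y Z ∘ f
      f̂ : Γ X Z ⇒ F₀ Y (Γ X Z + Γ Y Z , Z)
      f̂ = lift (Γ X Z + Γ Y Z , Z) f̄ ∘ F₁ id (inl , D.id) ∘ out X Z

    -- f‡ : the unique map with [ f‡ , id ] a coalgebra morphism from
    -- (Γ X Z + Γ Y Z , ‡-coalg Z f) to (Γ Y Z , out); i.e. coit (‡-coalg) ∘ inl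
    ‡ : ∀ {X Y} Z → X ⇒ Γ Y Z → Γ X Z ⇒ Γ Y Z
    ‡ {X} {Y} Z f = coit Y Z (‡-coalg Z f) ∘ inl

    νF₁ : ∀ {X X' Z Z'} → X ⇒ X' → Z D.⇒ Z' → Γ X Z ⇒ Γ X' Z'
    νF₁ {X} {X'} {Z} {Z'} f z = coit X' Z' (F₁ f (id , z) ∘ out X Z)

    νd : PMData D
    νd = record { F₀ = Γ ; F₁ = νF₁ ; η = ην ; lift = ‡ }

    νG : ∀ {g} → GuardData E g d → GuardData D g νd
    νG G {X} {Y} Z σ f = G (Γ Y Z , Z) σ (out Y Z ∘ f)

    ν† : ∀ {g} (G : GuardData E g d) → IterData E d G → IterData D νd (νG G)
    ν† G dag {X} {Y} Z f q =
      coit Y Z (lift P [ η P , dag P (out (Y + X) Z ∘ f) q ] ∘ out (Y + X) Z)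
        ∘ ην Z ∘ inr
      where
      P = (Γ (Y + X) Z , Z)

  νMor : (d : PMData E) (fin : Finals d) (d' : PMData E) (fin' : Finals d') →
         MorData E d d' → MorData D (Nu.νd d fin) (Nu.νd d' fin')
  νMor d fin d' fin' α {X} Z =
    Nu.coit d' fin' X Z (α (Nu.Γ d fin X Z , Z) ∘ Nu.out d fin X Z)

module Submission where

-- X #^ν Z is the final coalgebra of γ ↦ X # (γ , Z), so out is invertible (Lambek) and maps
-- into X #^ν Z are determined by their out-components.  The engine of the proof is
-- coiteration up to one Kleisli step: for a : A → X # (A , Z) and m : X → Y # (Y #^ν Z , Z)
-- there is exactly one h with  out ∘ h = m* ∘ (id # (h , id)) ∘ a.  The lifting f‡ is the
-- case a = out, m = out ∘ f, so each monad law, and each law making α^ν a monad morphism,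
-- follows by showing that both sides solve the same such equation.  Guardedness is transported
-- along out, because every id # (h , z) is a guarded monad morphism.  For iteration, with
-- s = (out ∘ f)† and K = coit ([η , s]* ∘ out), one has f^†† = K ∘ f and K = [η^ν , f^††]‡,
-- which is the fixpoint equation; uniqueness of solutions for # forces any other solution h
-- to satisfy [η^ν , h]‡ = K, hence h = f^††.

open import Level using (Level)
open import Data.Product using (_×_; _,_)
open import Relation.Binary using (IsEquivalence)
open import Relation.Binary.Bundles using (Setoid)
import Relation.Binary.Reasoning.Setoid as SetoidReasoning
open import Defs

module HomReasoning {o ℓ e} (C : Category o ℓ e) where
  open Category C

  hom-setoid : ∀ {A B} → Setoid ℓ e
  hom-setoid {A} {B} = record { Carrier = A ⇒ B ; _≈_ = _≈_ ; isEquivalence = equiv }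

  open module HomSetoid {A B} = Setoid (hom-setoid {A} {B}) public
    using () renaming (refl to ≈-refl; sym to ≈-sym; trans to ≈-trans)
  open module Reasoning {A B} = SetoidReasoning (hom-setoid {A} {B}) public

  infixr 4 _⟩∘⟨_ refl⟩∘⟨_
  infixl 5 _⟩∘⟨refl

  _⟩∘⟨_ : ∀ {A B C} {f h : B ⇒ C} {g i : A ⇒ B} → f ≈ h → g ≈ i → f ∘ g ≈ h ∘ i
  _⟩∘⟨_ = ∘-resp-≈

  refl⟩∘⟨_ : ∀ {A B C} {f : B ⇒ C} {g i : A ⇒ B} → g ≈ i → f ∘ g ≈ f ∘ i
  refl⟩∘⟨ p = ∘-resp-≈ ≈-refl p

  _⟩∘⟨refl : ∀ {A B C} {f h : B ⇒ C} {g : A ⇒ B} → f ≈ h → f ∘ g ≈ h ∘ g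
  p ⟩∘⟨refl = ∘-resp-≈ p ≈-refl

  sym-assoc : ∀ {A B C D} {f : A ⇒ B} {g : B ⇒ C} {h : C ⇒ D} →
              h ∘ (g ∘ f) ≈ (h ∘ g) ∘ f
  sym-assoc = ≈-sym assoc

  pullʳ : ∀ {A B C D} {a : C ⇒ D} {b : B ⇒ C} {c : A ⇒ B} {d : A ⇒ C} →
          b ∘ c ≈ d → (a ∘ b) ∘ c ≈ a ∘ d
  pullʳ p = ≈-trans assoc (refl⟩∘⟨ p)

  pullˡ : ∀ {A B C D} {a : C ⇒ D} {b : B ⇒ C} {c : A ⇒ B} {d : B ⇒ D} →
          a ∘ b ≈ d → a ∘ (b ∘ c) ≈ d ∘ c
  pullˡ p = ≈-trans sym-assoc (p ⟩∘⟨refl)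

module CoproductLemmas {o ℓ e} (C : Category o ℓ e) (cop : Coproducts C) where
  open Category C
  open Coproducts cop
  open HomReasoning C

  +-ext : ∀ {A B W} {f g : A + B ⇒ W} → f ∘ inl ≈ g ∘ inl → f ∘ inr ≈ g ∘ inr → f ≈ g
  +-ext p q = ≈-trans (≈-sym (unique ≈-refl ≈-refl)) (unique (≈-sym p) (≈-sym q))

  []-cong₂ : ∀ {A B W} {f f' : A ⇒ W} {g g' : B ⇒ W} →
             f ≈ f' → g ≈ g' → [ f , g ] ≈ [ f' , g' ]
  []-cong₂ p q = unique (≈-trans inject₁ (≈-sym p)) (≈-trans inject₂ (≈-sym q))

  ∘-distribˡ-[] : ∀ {A B W V} {h : W ⇒ V} {f : A ⇒ W} {g : B ⇒ W} →
                  h ∘ [ f , g ] ≈ [ h ∘ f , h ∘ g ]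
  ∘-distribˡ-[] = ≈-sym (unique (pullʳ inject₁) (pullʳ inject₂))

module Construction {o ℓ e o' ℓ' e'} (C : Category o ℓ e) (D : Category o' ℓ' e')
                    (cop : Coproducts C) where
  open Category C
  open Coproducts cop
  open Theory C D cop
  open HomReasoning C
  open CoproductLemmas C cop
  private
    module D = Category D
    module E = Category E
    D-refl : ∀ {A B} {z : A D.⇒ B} → z D.≈ z
    D-refl = IsEquivalence.refl D.equiv

  module NuMonad (d : PMData E) (fin : Finals d) (pm : IsParametrizedMonad E d) where
    open PMData d
    open IsParametrizedMonad pm
    open Nu d fin

    F₁ᵞ : ∀ {X A B Z} → A ⇒ B → F₀ X (A , Z) ⇒ F₀ X (B , Z)
    F₁ᵞ h = F₁ id (h , D.id)

    F₁-id-∘ : ∀ {X P Q R} {p : P E.⇒ Q} {q : Q E.⇒ R} →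
              F₁ (id {X}) q ∘ F₁ id p ≈ F₁ id (q E.∘ p)
    F₁-id-∘ = ≈-trans (≈-sym F-homomorphism) (F-resp-≈ identityˡ (≈-refl , D-refl))

    F₁ᵞ-∘ : ∀ {X A B B' Z} {h : B ⇒ B'} {k : A ⇒ B} →
            F₁ᵞ {X} {Z = Z} h ∘ F₁ᵞ k ≈ F₁ᵞ (h ∘ k)
    F₁ᵞ-∘ = ≈-trans F₁-id-∘ (F-resp-≈ ≈-refl (≈-refl , D.identityˡ))

    F₁ᵞ-resp-≈ : ∀ {X A B Z} {h h' : A ⇒ B} → h ≈ h' → F₁ᵞ {X} {Z = Z} h ≈ F₁ᵞ h'
    F₁ᵞ-resp-≈ p = F-resp-≈ ≈-refl (p , D-refl)

    F₁ᵞ-fuse : ∀ {X X' A B B' Z Z'} {f : X ⇒ X'} {h : B ⇒ B'} {k : A ⇒ B} {z : Z D.⇒ Z'} →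
               F₁ᵞ h ∘ F₁ f (k , z) ≈ F₁ f (h ∘ k , z)
    F₁ᵞ-fuse = ≈-trans (≈-sym F-homomorphism) (F-resp-≈ identityˡ (≈-refl , D.identityˡ))

    F₁-splitᵞ : ∀ {X X' A B Z Z'} {f : X ⇒ X'} {h : A ⇒ B} {z : Z D.⇒ Z'} →
               F₁ f (h , z) ≈ F₁ᵞ h ∘ F₁ f (id , z)
    F₁-splitᵞ = ≈-sym (≈-trans F₁ᵞ-fuse (F-resp-≈ ≈-refl (identityʳ , D-refl)))

    F₁-split-id : ∀ {X X' P P'} {f : X ⇒ X'} {p : P E.⇒ P'} → F₁ f p ≈ F₁ f E.id ∘ F₁ id p
    F₁-split-id = ≈-sym (≈-trans (≈-sym F-homomorphism) (F-resp-≈ identityʳ E.identityˡ))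

    F₁-∘-F₁ᵞ : ∀ {X X' A B B' Z Z'} {f : X ⇒ X'} {a : B ⇒ B'} {b : A ⇒ B} {z : Z D.⇒ Z'} →
               F₁ f (a , z) ∘ F₁ᵞ b ≈ F₁ᵞ (a ∘ b) ∘ F₁ f (id , z)
    F₁-∘-F₁ᵞ = ≈-trans (≈-sym F-homomorphism)
                 (≈-trans (F-resp-≈ identityʳ (≈-refl , D.identityʳ)) F₁-splitᵞ)

    F₁ᵞ-∘-F₁ : ∀ {X X' A B B' Z Z'} {f : X ⇒ X'} {a : A ⇒ B} {b : B ⇒ B'} {z : Z D.⇒ Z'} →
               F₁ᵞ b ∘ F₁ f (a , z) ≈ F₁ᵞ (b ∘ a) ∘ F₁ f (id , z)
    F₁ᵞ-∘-F₁ = ≈-trans F₁ᵞ-fuse F₁-splitᵞ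

    morph-lift-∘ : ∀ {X Y W P P'} (p : P E.⇒ P') (f : X ⇒ F₀ Y P) (r : W ⇒ F₀ X P) →
                   F₁ id p ∘ lift P f ∘ r ≈ lift P' (F₁ id p ∘ f) ∘ F₁ id p ∘ r
    morph-lift-∘ p f r = ≈-trans (pullˡ (morph-lift p f)) assoc

    coit-commutes : ∀ {X Z A} (a : A ⇒ F₀ X (A , Z)) →
                    out X Z ∘ coit X Z a ≈ F₁ᵞ (coit X Z a) ∘ a
    coit-commutes {X} {Z} = FinalCoalgebra.coit-commutes (fin X Z)

    coit-unique : ∀ {X Z A} (a : A ⇒ F₀ X (A , Z)) (h : A ⇒ Γ X Z) →
                  out X Z ∘ h ≈ F₁ᵞ h ∘ a → h ≈ coit X Z a
    coit-unique {X} {Z} = FinalCoalgebra.coit-unique (fin X Z)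

    coit-unique₂ : ∀ {X Z A} (a : A ⇒ F₀ X (A , Z)) {h h' : A ⇒ Γ X Z} →
                   out X Z ∘ h ≈ F₁ᵞ h ∘ a → out X Z ∘ h' ≈ F₁ᵞ h' ∘ a → h ≈ h'
    coit-unique₂ a {h} {h'} p p' = ≈-trans (coit-unique a h p) (≈-sym (coit-unique a h' p'))

    coit-resp-≈ : ∀ {X Z A} {a a' : A ⇒ F₀ X (A , Z)} → a ≈ a' → coit X Z a ≈ coit X Z a'
    coit-resp-≈ {a = a} {a'} p = coit-unique a' (coit _ _ a) (≈-trans (coit-commutes a) (refl⟩∘⟨ p))

    out-endo≈id : ∀ {X Z} {h : Γ X Z ⇒ Γ X Z} → out X Z ∘ h ≈ F₁ᵞ h ∘ out X Z → h ≈ id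
    out-endo≈id {X} {Z} p = coit-unique₂ (out X Z) p (begin
      out X Z ∘ id         ≈⟨ identityʳ ⟩
      out X Z              ≈⟨ identityˡ ⟨
      id ∘ out X Z         ≈⟨ F-identity ⟩∘⟨refl ⟨
      F₁ᵞ id ∘ out X Z     ∎)

    out⁻¹∘out : ∀ {X Z} → out⁻¹ X Z ∘ out X Z ≈ id
    out⁻¹∘out {X} {Z} = out-endo≈id (begin
      out X Z ∘ out⁻¹ X Z ∘ out X Z                 ≈⟨ pullˡ (coit-commutes _) ⟩
      (F₁ᵞ (out⁻¹ X Z) ∘ F₁ᵞ (out X Z)) ∘ out X Z   ≈⟨ F₁ᵞ-∘ ⟩∘⟨refl ⟩
      F₁ᵞ (out⁻¹ X Z ∘ out X Z) ∘ out X Z           ∎)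

    out∘out⁻¹ : ∀ {X Z} → out X Z ∘ out⁻¹ X Z ≈ id
    out∘out⁻¹ {X} {Z} = begin
      out X Z ∘ out⁻¹ X Z                 ≈⟨ coit-commutes _ ⟩
      F₁ᵞ (out⁻¹ X Z) ∘ F₁ᵞ (out X Z)     ≈⟨ F₁ᵞ-∘ ⟩
      F₁ᵞ (out⁻¹ X Z ∘ out X Z)           ≈⟨ F₁ᵞ-resp-≈ out⁻¹∘out ⟩
      F₁ᵞ id                              ≈⟨ F-identity ⟩
      id                                  ∎

    out-cancelˡ : ∀ {X Z A} {a b : A ⇒ Γ X Z} → out X Z ∘ a ≈ out X Z ∘ b → a ≈ b
    out-cancelˡ {X} {Z} {a = a} {b} p = begin
      a                           ≈⟨ identityˡ ⟨
      id ∘ a                      ≈⟨ out⁻¹∘out ⟩∘⟨refl ⟨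
      (out⁻¹ X Z ∘ out X Z) ∘ a   ≈⟨ pullʳ p ⟩
      out⁻¹ X Z ∘ out X Z ∘ b     ≈⟨ pullˡ out⁻¹∘out ⟩
      id ∘ b                      ≈⟨ identityˡ ⟩
      b                           ∎

    out∘ην : ∀ {X Z} → out X Z ∘ ην Z ≈ η (Γ X Z , Z)
    out∘ην = ≈-trans (pullˡ out∘out⁻¹) identityˡ

    Solves : ∀ {X Y Z A} → A ⇒ F₀ X (A , Z) → X ⇒ F₀ Y (Γ Y Z , Z) → A ⇒ Γ Y Z → Set e
    Solves {Y = Y} {Z} a m h = out Y Z ∘ h ≈ lift (Γ Y Z , Z) m ∘ F₁ᵞ h ∘ a

    -- Solutions of  out ∘ h = m* ∘ (id # (h , id)) ∘ a  are coiterations of a coalgebra on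
    -- A + Γ Y Z that makes one a-step, then one m-step, and from then on behaves as out.
    stepped : ∀ {X Y Z A} → A ⇒ F₀ X (A , Z) → X ⇒ F₀ Y (Γ Y Z , Z) →
              A + Γ Y Z ⇒ F₀ Y (A + Γ Y Z , Z)
    stepped {Y = Y} {Z} {A} a m =
      [ lift (A + Γ Y Z , Z) (F₁ᵞ inr ∘ m) ∘ F₁ᵞ inl ∘ a , F₁ᵞ inr ∘ out Y Z ]

    coit* : ∀ {X Y Z A} → A ⇒ F₀ X (A , Z) → X ⇒ F₀ Y (Γ Y Z , Z) → A ⇒ Γ Y Z
    coit* {Y = Y} {Z} a m = coit Y Z (stepped a m) ∘ inl

    module _ {X Y Z A} (a : A ⇒ F₀ X (A , Z)) (m : X ⇒ F₀ Y (Γ Y Z , Z)) where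
      private
        c = stepped a m
        K = coit Y Z c

      coit-stepped∘inr : K ∘ inr ≈ id
      coit-stepped∘inr = out-endo≈id (begin
        out Y Z ∘ K ∘ inr                 ≈⟨ pullˡ (coit-commutes c) ⟩
        (F₁ᵞ K ∘ c) ∘ inr                 ≈⟨ pullʳ inject₂ ⟩
        F₁ᵞ K ∘ F₁ᵞ inr ∘ out Y Z         ≈⟨ pullˡ F₁ᵞ-∘ ⟩
        F₁ᵞ (K ∘ inr) ∘ out Y Z           ∎)

      coit*-solves : Solves a m (coit* a m)
      coit*-solves = begin
        out Y Z ∘ K ∘ inl                                       ≈⟨ pullˡ (coit-commutes c) ⟩
        (F₁ᵞ K ∘ c) ∘ inl                                       ≈⟨ pullʳ inject₁ ⟩
        F₁ᵞ K ∘ lift _ (F₁ᵞ inr ∘ m) ∘ F₁ᵞ inl ∘ a             ≈⟨ morph-lift-∘ (K , D.id) _ _ ⟩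
        lift _ (F₁ᵞ K ∘ F₁ᵞ inr ∘ m) ∘ F₁ᵞ K ∘ F₁ᵞ inl ∘ a     ≈⟨ lift-resp _ F₁ᵞK∘inr ⟩∘⟨ pullˡ F₁ᵞ-∘ ⟩
        lift _ m ∘ F₁ᵞ (K ∘ inl) ∘ a                            ∎
        where
        F₁ᵞK∘inr : F₁ᵞ K ∘ F₁ᵞ inr ∘ m ≈ m
        F₁ᵞK∘inr = begin
          F₁ᵞ K ∘ F₁ᵞ inr ∘ m     ≈⟨ pullˡ F₁ᵞ-∘ ⟩
          F₁ᵞ (K ∘ inr) ∘ m       ≈⟨ F₁ᵞ-resp-≈ coit-stepped∘inr ⟩∘⟨refl ⟩
          F₁ᵞ id ∘ m              ≈⟨ F-identity ⟩∘⟨refl ⟩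
          id ∘ m                  ≈⟨ identityˡ ⟩
          m                       ∎

      coit*-unique : ∀ {h} → Solves a m h → h ≈ coit* a m
      coit*-unique {h} p = begin
          h                 ≈⟨ inject₁ ⟨
          [ h , id ] ∘ inl  ≈⟨ coit-unique c [ h , id ] copair-is-morphism ⟩∘⟨refl ⟩
          K ∘ inl           ∎
        where
        F₁ᵞ[h,id]∘inr : ∀ {W} {r : W ⇒ F₀ Y (Γ Y Z , Z)} → F₁ᵞ [ h , id ] ∘ F₁ᵞ inr ∘ r ≈ r
        F₁ᵞ[h,id]∘inr {r = r} = begin
          F₁ᵞ [ h , id ] ∘ F₁ᵞ inr ∘ r     ≈⟨ pullˡ F₁ᵞ-∘ ⟩
          F₁ᵞ ([ h , id ] ∘ inr) ∘ r       ≈⟨ F₁ᵞ-resp-≈ inject₂ ⟩∘⟨refl ⟩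
          F₁ᵞ id ∘ r                       ≈⟨ F-identity ⟩∘⟨refl ⟩
          id ∘ r                           ≈⟨ identityˡ ⟩
          r                                ∎

        copair-is-morphism : out Y Z ∘ [ h , id ] ≈ F₁ᵞ [ h , id ] ∘ c
        copair-is-morphism = +-ext
          (begin
            (out Y Z ∘ [ h , id ]) ∘ inl                                        ≈⟨ pullʳ inject₁ ⟩
            out Y Z ∘ h                                                         ≈⟨ p ⟩
            lift _ m ∘ F₁ᵞ h ∘ a
              ≈⟨ lift-resp _ F₁ᵞ[h,id]∘inr ⟩∘⟨ pullˡ (≈-trans F₁ᵞ-∘ (F₁ᵞ-resp-≈ inject₁)) ⟨
            lift _ (F₁ᵞ [ h , id ] ∘ F₁ᵞ inr ∘ m) ∘ F₁ᵞ [ h , id ] ∘ F₁ᵞ inl ∘ a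
              ≈⟨ morph-lift-∘ ([ h , id ] , D.id) _ _ ⟨
            F₁ᵞ [ h , id ] ∘ lift _ (F₁ᵞ inr ∘ m) ∘ F₁ᵞ inl ∘ a                 ≈⟨ pullʳ inject₁ ⟨
            (F₁ᵞ [ h , id ] ∘ c) ∘ inl                                          ∎)
          (begin
            (out Y Z ∘ [ h , id ]) ∘ inr                  ≈⟨ pullʳ inject₂ ⟩
            out Y Z ∘ id                                  ≈⟨ identityʳ ⟩
            out Y Z                                       ≈⟨ F₁ᵞ[h,id]∘inr ⟨
            F₁ᵞ [ h , id ] ∘ F₁ᵞ inr ∘ out Y Z            ≈⟨ pullʳ inject₂ ⟨
            (F₁ᵞ [ h , id ] ∘ c) ∘ inr                    ∎)

      Solves-unique₂ : ∀ {h h'} → Solves a m h → Solves a m h' → h ≈ h'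
      Solves-unique₂ p p' = ≈-trans (coit*-unique p) (≈-sym (coit*-unique p'))

    ‡-solves : ∀ {X Y Z} (f : X ⇒ Γ Y Z) → Solves (out X Z) (out Y Z ∘ f) (‡ Z f)
    ‡-solves {X} {Y} {Z} f = coit*-solves (out X Z) (out Y Z ∘ f)

    ‡-unique : ∀ {X Y Z} (f : X ⇒ Γ Y Z) {h : Γ X Z ⇒ Γ Y Z} →
               Solves (out X Z) (out Y Z ∘ f) h → h ≈ ‡ Z f
    ‡-unique {X} {Y} {Z} f = coit*-unique (out X Z) (out Y Z ∘ f)

    νF₁-commutes : ∀ {X X' Z Z'} (f : X ⇒ X') (z : Z D.⇒ Z') →
                   out X' Z' ∘ νF₁ f z ≈ F₁ f (νF₁ f z , z) ∘ out X Z
    νF₁-commutes f z = ≈-trans (coit-commutes _) (pullˡ (≈-sym F₁-splitᵞ))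

    νF₁-unique : ∀ {X X' Z Z'} (f : X ⇒ X') (z : Z D.⇒ Z') {h : Γ X Z ⇒ Γ X' Z'} →
                 out X' Z' ∘ h ≈ F₁ f (h , z) ∘ out X Z → h ≈ νF₁ f z
    νF₁-unique f z {h} p = coit-unique _ h
      (≈-trans p (≈-trans (F₁-splitᵞ ⟩∘⟨refl) assoc))

    νF₁-identity : ∀ {X Z} → νF₁ (id {X}) (D.id {Z}) ≈ id
    νF₁-identity = out-endo≈id (νF₁-commutes id D.id)

    νF₁-homomorphism : ∀ {X Y W P Q R} {f : X ⇒ Y} {g : Y ⇒ W} {p : P D.⇒ Q} {q : Q D.⇒ R} →
                       νF₁ (g ∘ f) (q D.∘ p) ≈ νF₁ g q ∘ νF₁ f p
    νF₁-homomorphism {X} {Y} {W} {P} {Q} {R} {f} {g} {p} {q} = ≈-sym (νF₁-unique _ _ (begin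
      out W R ∘ νF₁ g q ∘ νF₁ f p                       ≈⟨ pullˡ (νF₁-commutes g q) ⟩
      (F₁ g (νF₁ g q , q) ∘ out Y Q) ∘ νF₁ f p          ≈⟨ pullʳ (νF₁-commutes f p) ⟩
      F₁ g (νF₁ g q , q) ∘ F₁ f (νF₁ f p , p) ∘ out X P ≈⟨ pullˡ (≈-sym F-homomorphism) ⟩
      F₁ (g ∘ f) (νF₁ g q ∘ νF₁ f p , q D.∘ p) ∘ out X P ∎))

    νF₁-resp-≈ : ∀ {X Y P Q} {f f' : X ⇒ Y} {p p' : P D.⇒ Q} →
                 f ≈ f' → p D.≈ p' → νF₁ f p ≈ νF₁ f' p'
    νF₁-resp-≈ {f = f} {p = p} f≈f' p≈p' =
      νF₁-unique _ _ (≈-trans (νF₁-commutes f p) (F-resp-≈ f≈f' (≈-refl , p≈p') ⟩∘⟨refl))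

    ‡-resp-≈ : ∀ {X Y} Z {f g : X ⇒ Γ Y Z} → f ≈ g → ‡ Z f ≈ ‡ Z g
    ‡-resp-≈ Z {f} {g} f≈g =
      ‡-unique g (≈-trans (‡-solves f) (lift-resp _ (refl⟩∘⟨ f≈g) ⟩∘⟨refl))

    ‡∘ην : ∀ {X Y} Z (f : X ⇒ Γ Y Z) → ‡ Z f ∘ ην Z ≈ f
    ‡∘ην {X} {Y} Z f = out-cancelˡ (begin
      out Y Z ∘ ‡ Z f ∘ ην Z                                       ≈⟨ pullˡ (‡-solves f) ⟩
      (lift _ (out Y Z ∘ f) ∘ F₁ᵞ (‡ Z f) ∘ out X Z) ∘ ην Z         ≈⟨ pullʳ (pullʳ out∘ην) ⟩
      lift _ (out Y Z ∘ f) ∘ F₁ᵞ (‡ Z f) ∘ η _                      ≈⟨ refl⟩∘⟨ morph-η _ ⟩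
      lift _ (out Y Z ∘ f) ∘ η _                                    ≈⟨ lift-η _ _ ⟩
      out Y Z ∘ f                                                   ∎)

    ην‡≈id : ∀ {X} Z → ‡ Z (ην {X} Z) ≈ id
    ην‡≈id {X} Z = ≈-sym (‡-unique (ην Z) (begin
      out X Z ∘ id                              ≈⟨ identityʳ ⟩
      out X Z                                   ≈⟨ identityˡ ⟨
      id ∘ out X Z                              ≈⟨ η-lift _ ⟩∘⟨refl ⟨
      lift _ (η _) ∘ out X Z                    ≈⟨ lift-resp _ out∘ην ⟩∘⟨ ≈-trans (F-identity ⟩∘⟨refl) identityˡ ⟨
      lift _ (out X Z ∘ ην Z) ∘ F₁ᵞ id ∘ out X Z ∎))

    ‡-assoc : ∀ {X Y W} Z (f : X ⇒ Γ Y Z) (g : Y ⇒ Γ W Z) → ‡ Z (‡ Z g ∘ f) ≈ ‡ Z g ∘ ‡ Z f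
    ‡-assoc {X} {Y} {W} Z f g = ≈-sym (‡-unique _ (begin
      out W Z ∘ ‡ Z g ∘ ‡ Z f
        ≈⟨ pullˡ (‡-solves g) ⟩
      (lift _ (out W Z ∘ g) ∘ F₁ᵞ (‡ Z g) ∘ out Y Z) ∘ ‡ Z f
        ≈⟨ pullʳ (pullʳ (‡-solves f)) ⟩
      lift _ (out W Z ∘ g) ∘ F₁ᵞ (‡ Z g) ∘ lift _ (out Y Z ∘ f) ∘ F₁ᵞ (‡ Z f) ∘ out X Z
        ≈⟨ refl⟩∘⟨ morph-lift-∘ (‡ Z g , D.id) _ _ ⟩
      lift _ (out W Z ∘ g) ∘ lift _ (F₁ᵞ (‡ Z g) ∘ out Y Z ∘ f) ∘ F₁ᵞ (‡ Z g) ∘ F₁ᵞ (‡ Z f) ∘ out X Z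
        ≈⟨ pullˡ (≈-sym (lift-assoc _ _ _)) ⟩
      lift _ (lift _ (out W Z ∘ g) ∘ F₁ᵞ (‡ Z g) ∘ out Y Z ∘ f) ∘ F₁ᵞ (‡ Z g) ∘ F₁ᵞ (‡ Z f) ∘ out X Z
        ≈⟨ lift-resp _ ‡g-step ⟩∘⟨ pullˡ F₁ᵞ-∘ ⟩
      lift _ (out W Z ∘ ‡ Z g ∘ f) ∘ F₁ᵞ (‡ Z g ∘ ‡ Z f) ∘ out X Z
        ∎))
      where
      ‡g-step : lift _ (out W Z ∘ g) ∘ F₁ᵞ (‡ Z g) ∘ out Y Z ∘ f ≈ out W Z ∘ ‡ Z g ∘ f
      ‡g-step = ≈-trans (refl⟩∘⟨ sym-assoc) (≈-trans sym-assoc (≈-trans (≈-sym (‡-solves g) ⟩∘⟨refl) assoc))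

    νF₁≈‡ : ∀ {X Y} Z (f : X ⇒ Y) → νF₁ f (D.id {Z}) ≈ ‡ Z (ην Z ∘ f)
    νF₁≈‡ {X} {Y} Z f = ‡-unique _ (begin
      out Y Z ∘ νF₁ f D.id                              ≈⟨ νF₁-commutes f D.id ⟩
      F₁ f (νF₁ f D.id , D.id) ∘ out X Z                ≈⟨ F₁-split-id ⟩∘⟨refl ⟩
      (F₁ f E.id ∘ F₁ᵞ (νF₁ f D.id)) ∘ out X Z          ≈⟨ (F₁-lift _ f ⟩∘⟨refl) ⟩∘⟨refl ⟩
      (lift _ (η _ ∘ f) ∘ F₁ᵞ (νF₁ f D.id)) ∘ out X Z   ≈⟨ assoc ⟩
      lift _ (η _ ∘ f) ∘ F₁ᵞ (νF₁ f D.id) ∘ out X Z     ≈⟨ lift-resp _ (pullˡ out∘ην) ⟩∘⟨refl ⟨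
      lift _ (out Y Z ∘ ην Z ∘ f) ∘ F₁ᵞ (νF₁ f D.id) ∘ out X Z ∎)

    νF₁-morph-η : ∀ {X P P'} (p : P D.⇒ P') → νF₁ (id {X}) p ∘ ην P ≈ ην P'
    νF₁-morph-η {X} {P} {P'} p = out-cancelˡ (begin
      out X P' ∘ νF₁ id p ∘ ην P                 ≈⟨ pullˡ (νF₁-commutes id p) ⟩
      (F₁ id (νF₁ id p , p) ∘ out X P) ∘ ην P    ≈⟨ pullʳ out∘ην ⟩
      F₁ id (νF₁ id p , p) ∘ η _                 ≈⟨ morph-η _ ⟩
      η _                                        ≈⟨ out∘ην ⟨
      out X P' ∘ ην P'                           ∎)

    νF₁-morph-‡ : ∀ {X Y P P'} (p : P D.⇒ P') (f : X ⇒ Γ Y P) →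
                  νF₁ id p ∘ ‡ P f ≈ ‡ P' (νF₁ id p ∘ f) ∘ νF₁ id p
    νF₁-morph-‡ {X} {Y} {P} {P'} p f = Solves-unique₂ (F₁ id (id , p) ∘ out X P) m lhs-solves rhs-solves
      where
      n = νF₁ {Y} id p
      m = out Y P' ∘ n ∘ f

      lhs-solves : Solves (F₁ id (id , p) ∘ out X P) m (n ∘ ‡ P f)
      lhs-solves = begin
        out Y P' ∘ n ∘ ‡ P f                                             ≈⟨ pullˡ (νF₁-commutes id p) ⟩
        (F₁ id (n , p) ∘ out Y P) ∘ ‡ P f                                ≈⟨ pullʳ (‡-solves f) ⟩
        F₁ id (n , p) ∘ lift _ (out Y P ∘ f) ∘ F₁ᵞ (‡ P f) ∘ out X P      ≈⟨ morph-lift-∘ _ _ _ ⟩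
        lift _ (F₁ id (n , p) ∘ out Y P ∘ f) ∘ F₁ id (n , p) ∘ F₁ᵞ (‡ P f) ∘ out X P
          ≈⟨ lift-resp _ (pullˡ (≈-sym (νF₁-commutes id p))) ⟩∘⟨ pullˡ F₁-∘-F₁ᵞ ⟩
        lift _ ((out Y P' ∘ n) ∘ f) ∘ (F₁ᵞ (n ∘ ‡ P f) ∘ F₁ id (id , p)) ∘ out X P
          ≈⟨ lift-resp _ assoc ⟩∘⟨ assoc ⟩
        lift _ m ∘ F₁ᵞ (n ∘ ‡ P f) ∘ F₁ id (id , p) ∘ out X P             ∎

      rhs-solves : Solves (F₁ id (id , p) ∘ out X P) m (‡ P' (n ∘ f) ∘ νF₁ id p)
      rhs-solves = begin
        out Y P' ∘ ‡ P' (n ∘ f) ∘ νF₁ id p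
          ≈⟨ pullˡ (‡-solves _) ⟩
        (lift _ m ∘ F₁ᵞ (‡ P' (n ∘ f)) ∘ out X P') ∘ νF₁ id p
          ≈⟨ pullʳ (pullʳ (νF₁-commutes id p)) ⟩
        lift _ m ∘ F₁ᵞ (‡ P' (n ∘ f)) ∘ F₁ id (νF₁ id p , p) ∘ out X P
          ≈⟨ refl⟩∘⟨ pullˡ F₁ᵞ-∘-F₁ ⟩
        lift _ m ∘ (F₁ᵞ (‡ P' (n ∘ f) ∘ νF₁ id p) ∘ F₁ id (id , p)) ∘ out X P
          ≈⟨ refl⟩∘⟨ assoc ⟩
        lift _ m ∘ F₁ᵞ (‡ P' (n ∘ f) ∘ νF₁ id p) ∘ F₁ id (id , p) ∘ out X P
          ∎

    isParametrizedMonad : IsParametrizedMonad D νd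
    isParametrizedMonad = record
      { F-identity = νF₁-identity
      ; F-homomorphism = νF₁-homomorphism
      ; F-resp-≈ = νF₁-resp-≈
      ; lift-resp = ‡-resp-≈
      ; lift-η = ‡∘ην
      ; η-lift = ην‡≈id
      ; lift-assoc = ‡-assoc
      ; F₁-lift = νF₁≈‡
      ; morph-η = νF₁-morph-η
      ; morph-lift = νF₁-morph-‡
      }

    module Guarded {g} (G : GuardData E g d) (pg : IsParametrizedGuarded E d G) where
      open IsParametrizedGuarded pg

      νG-trv : ∀ {X Y Z P} (f : X ⇒ Γ Y P) → νG G P (inrS {Y} {Z}) (νF₁ inl D.id ∘ f)
      νG-trv {X} {Y} {Z} {P} f = resp
        (begin
          F₁ᵞ (νF₁ inl D.id) ∘ F₁ inl E.id ∘ out Y P ∘ f   ≈⟨ pullˡ (≈-sym F₁-splitᵞ) ⟩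
          F₁ inl (νF₁ inl D.id , D.id) ∘ out Y P ∘ f      ≈⟨ pullˡ (≈-sym (νF₁-commutes inl D.id)) ⟩
          (out (Y + Z) P ∘ νF₁ inl D.id) ∘ f              ≈⟨ assoc ⟩
          out (Y + Z) P ∘ νF₁ inl D.id ∘ f                ∎)
        (preserve (νF₁ inl D.id , D.id) _ (trv (out Y P ∘ f)))

      νG-par : ∀ {X Y Z P} {σ : Summand Z} {f : X ⇒ Γ Z P} {h : Y ⇒ Γ Z P} →
               νG G P σ f → νG G P σ h → νG G P σ [ f , h ]
      νG-par qf qh = resp (≈-sym ∘-distribˡ-[]) (par qf qh)

      νG-cmp : ∀ {X Y Z V P} {σ : Summand V} (f : X ⇒ Γ (Y + Z) P)
                 (h₁ : Y ⇒ Γ V P) (h₂ : Z ⇒ Γ V P) →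
               νG G P inrS f → νG G P σ h₁ → νG G P σ (‡ P [ h₁ , h₂ ] ∘ f)
      νG-cmp {Y = Y} {Z} {V} {P} f h₁ h₂ qf qh₁ = resp
        (begin
          lift _ [ out V P ∘ h₁ , out V P ∘ h₂ ] ∘ F₁ᵞ (‡ P [ h₁ , h₂ ]) ∘ out (Y + Z) P ∘ f
            ≈⟨ lift-resp _ ∘-distribˡ-[] ⟩∘⟨refl ⟨
          lift _ (out V P ∘ [ h₁ , h₂ ]) ∘ F₁ᵞ (‡ P [ h₁ , h₂ ]) ∘ out (Y + Z) P ∘ f
            ≈⟨ ≈-trans (refl⟩∘⟨ sym-assoc) sym-assoc ⟩
          (lift _ (out V P ∘ [ h₁ , h₂ ]) ∘ F₁ᵞ (‡ P [ h₁ , h₂ ]) ∘ out (Y + Z) P) ∘ f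
            ≈⟨ pullˡ (‡-solves [ h₁ , h₂ ]) ⟨
          out V P ∘ ‡ P [ h₁ , h₂ ] ∘ f
            ∎)
        (cmp _ (out V P ∘ h₁) (out V P ∘ h₂) (preserve (‡ P [ h₁ , h₂ ] , D.id) _ qf) qh₁)

      νG-preserve : ∀ {X Y P P'} (p : P D.⇒ P') {σ : Summand Y} (f : X ⇒ Γ Y P) →
                    νG G P σ f → νG G P' σ (νF₁ id p ∘ f)
      νG-preserve p f q =
        resp (≈-trans (pullˡ (≈-sym (νF₁-commutes id p))) assoc) (preserve (νF₁ id p , p) _ q)

      isParametrizedGuarded : IsParametrizedGuarded D νd (νG G)
      isParametrizedGuarded = record
        { resp = λ f≈f' → resp (refl⟩∘⟨ f≈f')
        ; trv = νG-trv
        ; par = νG-par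
        ; cmp = νG-cmp
        ; preserve = νG-preserve
        }

    module PreIterative {g} (G : GuardData E g d) (dag : IterData E d G)
                        (pi : IsGuardedPreIterative E d G dag) where
      open IsGuardedPreIterative pi
      private module PG = IsParametrizedGuarded isGuarded

      module Solution {X Y Z} (f : X ⇒ Γ (Y + X) Z) (q : νG G Z inrS f) where
        P : E.Obj
        P = (Γ (Y + X) Z , Z)

        s : X ⇒ F₀ Y P
        s = dag P (out (Y + X) Z ∘ f) q

        c : Γ (Y + X) Z ⇒ F₀ Y P
        c = lift P [ η P , s ] ∘ out (Y + X) Z

        K : Γ (Y + X) Z ⇒ Γ Y Z
        K = coit Y Z c

        out∘ν† : out Y Z ∘ ν† G dag Z f q ≈ F₁ᵞ K ∘ s
        out∘ν† = begin
          out Y Z ∘ K ∘ ην Z ∘ inr            ≈⟨ pullˡ (coit-commutes c) ⟩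
          (F₁ᵞ K ∘ c) ∘ ην Z ∘ inr            ≈⟨ pullʳ (pullʳ (pullˡ out∘ην)) ⟩
          F₁ᵞ K ∘ lift P [ η P , s ] ∘ η P ∘ inr ≈⟨ refl⟩∘⟨ pullˡ (lift-η P _) ⟩
          F₁ᵞ K ∘ [ η P , s ] ∘ inr           ≈⟨ refl⟩∘⟨ inject₂ ⟩
          F₁ᵞ K ∘ s                           ∎

        ν†≈K∘f : ν† G dag Z f q ≈ K ∘ f
        ν†≈K∘f = out-cancelˡ (begin
          out Y Z ∘ ν† G dag Z f q                    ≈⟨ out∘ν† ⟩
          F₁ᵞ K ∘ s                                   ≈⟨ refl⟩∘⟨ fixpoint _ q ⟩
          F₁ᵞ K ∘ lift P [ η P , s ] ∘ out (Y + X) Z ∘ f ≈⟨ refl⟩∘⟨ sym-assoc ⟩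
          F₁ᵞ K ∘ c ∘ f                               ≈⟨ pullˡ (≈-sym (coit-commutes c)) ⟩
          (out Y Z ∘ K) ∘ f                           ≈⟨ assoc ⟩
          out Y Z ∘ K ∘ f                             ∎)

        K≈‡ : K ≈ ‡ Z [ ην Z , ν† G dag Z f q ]
        K≈‡ = ‡-unique _ (begin
          out Y Z ∘ K                                          ≈⟨ coit-commutes c ⟩
          F₁ᵞ K ∘ lift P [ η P , s ] ∘ out (Y + X) Z           ≈⟨ morph-lift-∘ (K , D.id) _ _ ⟩
          lift _ (F₁ᵞ K ∘ [ η P , s ]) ∘ F₁ᵞ K ∘ out (Y + X) Z ≈⟨ lift-resp _ F₁ᵞK∘[η,s] ⟩∘⟨refl ⟩
          lift _ (out Y Z ∘ [ ην Z , ν† G dag Z f q ]) ∘ F₁ᵞ K ∘ out (Y + X) Z ∎)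
          where
          F₁ᵞK∘[η,s] : F₁ᵞ K ∘ [ η P , s ] ≈ out Y Z ∘ [ ην Z , ν† G dag Z f q ]
          F₁ᵞK∘[η,s] = ≈-trans ∘-distribˡ-[]
            (≈-trans ([]-cong₂ (≈-trans (morph-η _) (≈-sym out∘ην)) (≈-sym out∘ν†))
                     (≈-sym ∘-distribˡ-[]))

      ν†-resp-≈ : ∀ {X Y Z} {f f' : X ⇒ Γ (Y + X) Z} (q : νG G Z inrS f) (q' : νG G Z inrS f') →
                  f ≈ f' → ν† G dag Z f q ≈ ν† G dag Z f' q'
      ν†-resp-≈ q q' f≈f' =
        coit-resp-≈ (lift-resp _ ([]-cong₂ ≈-refl (dag-resp q q' (refl⟩∘⟨ f≈f'))) ⟩∘⟨refl)
          ⟩∘⟨refl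

      ν†-fixpoint : ∀ {X Y Z} (f : X ⇒ Γ (Y + X) Z) (q : νG G Z inrS f) →
                    ν† G dag Z f q ≈ ‡ Z [ ην Z , ν† G dag Z f q ] ∘ f
      ν†-fixpoint f q = ≈-trans ν†≈K∘f (K≈‡ ⟩∘⟨refl)
        where open Solution f q

      ν†-natural : ∀ {X Y P₀ P₁} (p : P₀ D.⇒ P₁) (f : X ⇒ Γ (Y + X) P₀)
                     (q : νG G P₀ inrS f) (q' : νG G P₁ inrS (νF₁ id p ∘ f)) →
                   νF₁ id p ∘ ν† G dag P₀ f q ≈ ν† G dag P₁ (νF₁ id p ∘ f) q'
      ν†-natural {X} {Y} {P₀} {P₁} p f q q' = begin
          nY ∘ ν† G dag P₀ f q                  ≈⟨ refl⟩∘⟨ S₀.ν†≈K∘f ⟩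
          nY ∘ S₀.K ∘ f                         ≈⟨ pullˡ K-natural ⟩
          (S₁.K ∘ n) ∘ f                        ≈⟨ assoc ⟩
          S₁.K ∘ n ∘ f                          ≈⟨ S₁.ν†≈K∘f ⟨
          ν† G dag P₁ (νF₁ id p ∘ f) q'         ∎
        where
        module S₀ = Solution f q
        module S₁ = Solution (νF₁ id p ∘ f) q'
        n = νF₁ {Y + X} id p
        nY = νF₁ {Y} id p

        s-natural : S₁.s ≈ F₁ id (n , p) ∘ S₀.s
        s-natural = ≈-trans (dag-resp q' q'' (≈-trans (pullˡ (νF₁-commutes id p)) assoc))
                            (≈-sym (natural (n , p) _ q q''))
          where q'' = PG.preserve (n , p) (out (Y + X) P₀ ∘ f) q

        lift-natural : lift S₁.P [ η S₁.P , S₁.s ] ∘ F₁ id (n , p) ≈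
                       F₁ id (n , p) ∘ lift S₀.P [ η S₀.P , S₀.s ]
        lift-natural = ≈-sym (≈-trans (morph-lift _ _)
          (lift-resp _ (≈-trans ∘-distribˡ-[] ([]-cong₂ (morph-η _) (≈-sym s-natural))) ⟩∘⟨refl))

        K-natural : nY ∘ S₀.K ≈ S₁.K ∘ n
        K-natural = coit-unique₂ (F₁ id (id , p) ∘ S₀.c)
          (begin
            out Y P₁ ∘ nY ∘ S₀.K                          ≈⟨ pullˡ (νF₁-commutes id p) ⟩
            (F₁ id (nY , p) ∘ out Y P₀) ∘ S₀.K            ≈⟨ pullʳ (coit-commutes S₀.c) ⟩
            F₁ id (nY , p) ∘ F₁ᵞ S₀.K ∘ S₀.c              ≈⟨ pullˡ F₁-∘-F₁ᵞ ⟩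
            (F₁ᵞ (nY ∘ S₀.K) ∘ F₁ id (id , p)) ∘ S₀.c     ≈⟨ assoc ⟩
            F₁ᵞ (nY ∘ S₀.K) ∘ F₁ id (id , p) ∘ S₀.c       ∎)
          (begin
            out Y P₁ ∘ S₁.K ∘ n                           ≈⟨ pullˡ (coit-commutes S₁.c) ⟩
            (F₁ᵞ S₁.K ∘ S₁.c) ∘ n                         ≈⟨ pullʳ (pullʳ (νF₁-commutes id p)) ⟩
            F₁ᵞ S₁.K ∘ lift S₁.P [ η S₁.P , S₁.s ] ∘ F₁ id (n , p) ∘ out (Y + X) P₀
              ≈⟨ refl⟩∘⟨ pullˡ lift-natural ⟩
            F₁ᵞ S₁.K ∘ (F₁ id (n , p) ∘ lift S₀.P [ η S₀.P , S₀.s ]) ∘ out (Y + X) P₀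
              ≈⟨ refl⟩∘⟨ assoc ⟩
            F₁ᵞ S₁.K ∘ F₁ id (n , p) ∘ S₀.c               ≈⟨ pullˡ F₁ᵞ-∘-F₁ ⟩
            (F₁ᵞ (S₁.K ∘ n) ∘ F₁ id (id , p)) ∘ S₀.c      ≈⟨ assoc ⟩
            F₁ᵞ (S₁.K ∘ n) ∘ F₁ id (id , p) ∘ S₀.c        ∎)

      isGuardedPreIterative : IsGuardedPreIterative D νd (νG G) (ν† G dag)
      isGuardedPreIterative = record
        { isGuarded = Guarded.isParametrizedGuarded G isGuarded
        ; dag-resp = ν†-resp-≈
        ; fixpoint = ν†-fixpoint
        ; natural = ν†-natural
        }

    module Iterative {g} (G : GuardData E g d) (dag : IterData E d G)
                     (it : IsGuardedIterative E d G dag) where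
      open IsGuardedIterative it
      open IsGuardedPreIterative isPreIterative
      open PreIterative G dag isPreIterative
        using (module Solution; isGuardedPreIterative)
      private module PG = IsParametrizedGuarded isGuarded

      ν†-unique : ∀ {X Y Z} (f : X ⇒ Γ (Y + X) Z) (q : νG G Z inrS f) (h : X ⇒ Γ Y Z) →
                  h ≈ ‡ Z [ ην Z , h ] ∘ f → h ≈ ν† G dag Z f q
      ν†-unique {X} {Y} {Z} f q h h-solves = begin
          h          ≈⟨ h-solves ⟩
          L ∘ f      ≈⟨ L≈K ⟩∘⟨refl ⟩
          K ∘ f      ≈⟨ ν†≈K∘f ⟨
          ν† G dag Z f q ∎
        where
        open Solution f q
        L = ‡ Z [ ην Z , h ]
        PY = (Γ Y Z , Z)
        qL = PG.preserve (L , D.id) (out (Y + X) Z ∘ f) q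

        out∘h≈† : out Y Z ∘ h ≈ dag PY (F₁ᵞ L ∘ out (Y + X) Z ∘ f) qL
        out∘h≈† = unique-solution _ qL (out Y Z ∘ h) (begin
          out Y Z ∘ h                                                   ≈⟨ refl⟩∘⟨ h-solves ⟩
          out Y Z ∘ L ∘ f                                               ≈⟨ pullˡ (‡-solves _) ⟩
          (lift PY (out Y Z ∘ [ ην Z , h ]) ∘ F₁ᵞ L ∘ out (Y + X) Z) ∘ f ≈⟨ pullʳ assoc ⟩
          lift PY (out Y Z ∘ [ ην Z , h ]) ∘ F₁ᵞ L ∘ out (Y + X) Z ∘ f
            ≈⟨ lift-resp _ (≈-trans ∘-distribˡ-[] ([]-cong₂ out∘ην ≈-refl)) ⟩∘⟨refl ⟩
          lift PY [ η PY , out Y Z ∘ h ] ∘ F₁ᵞ L ∘ out (Y + X) Z ∘ f    ∎)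

        out∘h≈F₁ᵞL∘s : out Y Z ∘ h ≈ F₁ᵞ L ∘ s
        out∘h≈F₁ᵞL∘s = ≈-trans out∘h≈† (≈-sym (natural (L , D.id) _ q qL))

        L≈K : L ≈ K
        L≈K = coit-unique c L (begin
          out Y Z ∘ L                                                ≈⟨ ‡-solves _ ⟩
          lift PY (out Y Z ∘ [ ην Z , h ]) ∘ F₁ᵞ L ∘ out (Y + X) Z   ≈⟨ lift-resp _ out∘[ην,h] ⟩∘⟨refl ⟩
          lift PY (F₁ᵞ L ∘ [ η P , s ]) ∘ F₁ᵞ L ∘ out (Y + X) Z      ≈⟨ morph-lift-∘ (L , D.id) _ _ ⟨
          F₁ᵞ L ∘ c                                                  ∎)
          where
          out∘[ην,h] : out Y Z ∘ [ ην Z , h ] ≈ F₁ᵞ L ∘ [ η P , s ]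
          out∘[ην,h] = ≈-trans ∘-distribˡ-[]
            (≈-trans ([]-cong₂ (≈-trans out∘ην (≈-sym (morph-η _))) out∘h≈F₁ᵞL∘s)
                     (≈-sym ∘-distribˡ-[]))

      isGuardedIterative : IsGuardedIterative D νd (νG G) (ν† G dag)
      isGuardedIterative = record
        { isPreIterative = isGuardedPreIterative
        ; unique-solution = ν†-unique
        }

  module NuMorphism (d : PMData E) (fin : Finals d) (pm : IsParametrizedMonad E d)
                    (d' : PMData E) (fin' : Finals d') (pm' : IsParametrizedMonad E d')
                    (α : MorData E d d') (αm : IsParametrizedMonadMorphism E d d' α) where
    private
      module N = Nu d fin
      module N' = Nu d' fin'
      module A = NuMonad d fin pm
      module B = NuMonad d' fin' pm'
      module P = PMData d
      module P' = PMData d'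
      module PM' = IsParametrizedMonad pm'
    open IsParametrizedMonadMorphism αm

    αν : ∀ {X} Z → N.Γ X Z ⇒ N'.Γ X Z
    αν = νMor d fin d' fin' α

    αν-commutes : ∀ {X Z} → N'.out X Z ∘ αν Z ≈ B.F₁ᵞ (αν Z) ∘ α _ ∘ N.out X Z
    αν-commutes = B.coit-commutes _

    αν-natural : ∀ {X X' Z Z'} (f : X ⇒ X') (z : Z D.⇒ Z') →
                 αν Z' ∘ N.νF₁ f z ≈ N'.νF₁ f z ∘ αν Z
    αν-natural {X} {X'} {Z} {Z'} f z = B.coit-unique₂ (P'.F₁ f (id , z) ∘ α _ ∘ N.out X Z)
      (begin
        N'.out X' Z' ∘ αν Z' ∘ N.νF₁ f z
          ≈⟨ pullˡ αν-commutes ⟩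
        (B.F₁ᵞ (αν Z') ∘ α _ ∘ N.out X' Z') ∘ N.νF₁ f z
          ≈⟨ pullʳ (pullʳ (A.νF₁-commutes f z)) ⟩
        B.F₁ᵞ (αν Z') ∘ α _ ∘ P.F₁ f (N.νF₁ f z , z) ∘ N.out X Z
          ≈⟨ refl⟩∘⟨ pullˡ (natural _ _) ⟩
        B.F₁ᵞ (αν Z') ∘ (P'.F₁ f (N.νF₁ f z , z) ∘ α _) ∘ N.out X Z
          ≈⟨ pullˡ (≈-trans sym-assoc (B.F₁ᵞ-∘-F₁ ⟩∘⟨refl)) ⟩
        ((B.F₁ᵞ (αν Z' ∘ N.νF₁ f z) ∘ P'.F₁ f (id , z)) ∘ α _) ∘ N.out X Z
          ≈⟨ ≈-trans assoc assoc ⟩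
        B.F₁ᵞ (αν Z' ∘ N.νF₁ f z) ∘ P'.F₁ f (id , z) ∘ α _ ∘ N.out X Z
          ∎)
      (begin
        N'.out X' Z' ∘ N'.νF₁ f z ∘ αν Z
          ≈⟨ pullˡ (B.νF₁-commutes f z) ⟩
        (P'.F₁ f (N'.νF₁ f z , z) ∘ N'.out X Z) ∘ αν Z
          ≈⟨ pullʳ αν-commutes ⟩
        P'.F₁ f (N'.νF₁ f z , z) ∘ B.F₁ᵞ (αν Z) ∘ α _ ∘ N.out X Z
          ≈⟨ pullˡ B.F₁-∘-F₁ᵞ ⟩
        (B.F₁ᵞ (N'.νF₁ f z ∘ αν Z) ∘ P'.F₁ f (id , z)) ∘ α _ ∘ N.out X Z
          ≈⟨ assoc ⟩
        B.F₁ᵞ (N'.νF₁ f z ∘ αν Z) ∘ P'.F₁ f (id , z) ∘ α _ ∘ N.out X Z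
          ∎)

    αν-η : ∀ {X} Z → αν Z ∘ N.ην {X} Z ≈ N'.ην Z
    αν-η {X} Z = B.out-cancelˡ (begin
      N'.out X Z ∘ αν Z ∘ N.ην Z                     ≈⟨ pullˡ αν-commutes ⟩
      (B.F₁ᵞ (αν Z) ∘ α _ ∘ N.out X Z) ∘ N.ην Z      ≈⟨ pullʳ (pullʳ A.out∘ην) ⟩
      B.F₁ᵞ (αν Z) ∘ α _ ∘ P.η _                     ≈⟨ refl⟩∘⟨ α-η _ ⟩
      B.F₁ᵞ (αν Z) ∘ P'.η _                          ≈⟨ PM'.morph-η _ ⟩
      P'.η _                                         ≈⟨ B.out∘ην ⟨
      N'.out X Z ∘ N'.ην Z                           ∎)

    αν-‡ : ∀ {X Y} Z (f : X ⇒ N.Γ Y Z) → αν Z ∘ N.‡ Z f ≈ N'.‡ Z (αν Z ∘ f) ∘ αν Z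
    αν-‡ {X} {Y} Z f = B.Solves-unique₂ (α _ ∘ N.out X Z) m lhs-solves rhs-solves
      where
      m = N'.out Y Z ∘ αν Z ∘ f

      lhs-solves : B.Solves (α _ ∘ N.out X Z) m (αν Z ∘ N.‡ Z f)
      lhs-solves = begin
        N'.out Y Z ∘ αν Z ∘ N.‡ Z f
          ≈⟨ pullˡ αν-commutes ⟩
        (B.F₁ᵞ (αν Z) ∘ α _ ∘ N.out Y Z) ∘ N.‡ Z f
          ≈⟨ pullʳ (pullʳ (A.‡-solves f)) ⟩
        B.F₁ᵞ (αν Z) ∘ α _ ∘ P.lift _ (N.out Y Z ∘ f) ∘ A.F₁ᵞ (N.‡ Z f) ∘ N.out X Z
          ≈⟨ refl⟩∘⟨ ≈-trans (pullˡ (α-lift _ _)) assoc ⟩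
        B.F₁ᵞ (αν Z) ∘ P'.lift _ (α _ ∘ N.out Y Z ∘ f) ∘ α _ ∘ A.F₁ᵞ (N.‡ Z f) ∘ N.out X Z
          ≈⟨ refl⟩∘⟨ refl⟩∘⟨ pullˡ (natural _ _) ⟩
        B.F₁ᵞ (αν Z) ∘ P'.lift _ (α _ ∘ N.out Y Z ∘ f) ∘ (B.F₁ᵞ (N.‡ Z f) ∘ α _) ∘ N.out X Z
          ≈⟨ B.morph-lift-∘ (αν Z , D.id) _ _ ⟩
        P'.lift _ (B.F₁ᵞ (αν Z) ∘ α _ ∘ N.out Y Z ∘ f) ∘ B.F₁ᵞ (αν Z) ∘ (B.F₁ᵞ (N.‡ Z f) ∘ α _) ∘ N.out X Z
          ≈⟨ PM'.lift-resp _ m≈ ⟩∘⟨ ≈-trans (refl⟩∘⟨ assoc) (pullˡ B.F₁ᵞ-∘) ⟩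
        P'.lift _ m ∘ B.F₁ᵞ (αν Z ∘ N.‡ Z f) ∘ α _ ∘ N.out X Z
          ∎
        where
        m≈ : B.F₁ᵞ (αν Z) ∘ α _ ∘ N.out Y Z ∘ f ≈ m
        m≈ = ≈-trans (refl⟩∘⟨ sym-assoc) (≈-trans sym-assoc (≈-trans (≈-sym αν-commutes ⟩∘⟨refl) assoc))

      rhs-solves : B.Solves (α _ ∘ N.out X Z) m (N'.‡ Z (αν Z ∘ f) ∘ αν Z)
      rhs-solves = begin
        N'.out Y Z ∘ N'.‡ Z (αν Z ∘ f) ∘ αν Z
          ≈⟨ pullˡ (B.‡-solves _) ⟩
        (P'.lift _ m ∘ B.F₁ᵞ (N'.‡ Z (αν Z ∘ f)) ∘ N'.out X Z) ∘ αν Z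
          ≈⟨ pullʳ (pullʳ αν-commutes) ⟩
        P'.lift _ m ∘ B.F₁ᵞ (N'.‡ Z (αν Z ∘ f)) ∘ B.F₁ᵞ (αν Z) ∘ α _ ∘ N.out X Z
          ≈⟨ refl⟩∘⟨ pullˡ B.F₁ᵞ-∘ ⟩
        P'.lift _ m ∘ B.F₁ᵞ (N'.‡ Z (αν Z ∘ f) ∘ αν Z) ∘ α _ ∘ N.out X Z
          ∎

    isParametrizedMonadMorphism : IsParametrizedMonadMorphism D N.νd N'.νd αν
    isParametrizedMonadMorphism = record
      { natural = αν-natural
      ; α-η = αν-η
      ; α-lift = αν-‡
      }

    module Guarded {g} (G : GuardData E g d) (G' : GuardData E g d')
                   (pg' : IsParametrizedGuarded E d' G')
                   (αg : IsParametrizedGuardedMonadMorphism E d G d' G' α) where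
      private
        module PG' = IsParametrizedGuarded pg'
        module AG = IsParametrizedGuardedMonadMorphism αg

      αν-preserve : ∀ {X Y Z} {σ : Summand Y} (f : X ⇒ N.Γ Y Z) →
                    N.νG G Z σ f → N'.νG G' Z σ (αν Z ∘ f)
      αν-preserve {Z = Z} f q = PG'.resp
        (≈-sym (≈-trans (pullˡ αν-commutes) (≈-trans assoc (refl⟩∘⟨ assoc))))
        (PG'.preserve (αν Z , D.id) _ (AG.preserve _ q))

      isParametrizedGuardedMonadMorphism :
        IsParametrizedGuardedMonadMorphism D N.νd (N.νG G) N'.νd (N'.νG G') αν
      isParametrizedGuardedMonadMorphism = record
        { isMorphism = isParametrizedMonadMorphism
        ; preserve = αν-preserve
        }

  νMor-identity : (d : PMData E) (fin : Finals d) → IsParametrizedMonad E d →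
                  ∀ X Z → νMor d fin d fin (idMor E d) {X} Z ≈ id
  νMor-identity d fin pm X Z =
    out-endo≈id (≈-trans (coit-commutes _) (refl⟩∘⟨ identityˡ))
    where open NuMonad d fin pm

  νMor-∘ : (d : PMData E) (fin : Finals d) (d' : PMData E) (fin' : Finals d')
           (d'' : PMData E) (fin'' : Finals d'') → IsParametrizedMonad E d'' →
           (α : MorData E d d') (β : MorData E d' d'') →
           IsParametrizedMonadMorphism E d' d'' β →
           ∀ X Z → νMor d fin d'' fin'' (compMor E {d} {d'} {d''} β α) {X} Z
                  ≈ νMor d' fin' d'' fin'' β {X} Z ∘ νMor d fin d' fin' α {X} Z
  νMor-∘ d fin d' fin' d'' fin'' pm'' α β βm X Z = ≈-sym (coit-unique _ _ (begin
      N''.out X Z ∘ βν ∘ αν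
        ≈⟨ pullˡ (coit-commutes _) ⟩
      (F₁ᵞ βν ∘ β _ ∘ N'.out X Z) ∘ αν
        ≈⟨ pullʳ (pullʳ (FinalCoalgebra.coit-commutes (fin' X Z) _)) ⟩
      F₁ᵞ βν ∘ β _ ∘ PMData.F₁ d' id (αν , D.id) ∘ α _ ∘ N.out X Z
        ≈⟨ refl⟩∘⟨ pullˡ (IsParametrizedMonadMorphism.natural βm _ _) ⟩
      F₁ᵞ βν ∘ (F₁ᵞ αν ∘ β _) ∘ α _ ∘ N.out X Z
        ≈⟨ pullˡ (≈-trans sym-assoc (F₁ᵞ-∘ ⟩∘⟨refl)) ⟩
      (F₁ᵞ (βν ∘ αν) ∘ β _) ∘ α _ ∘ N.out X Z
        ≈⟨ ≈-trans assoc (refl⟩∘⟨ sym-assoc) ⟩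
      F₁ᵞ (βν ∘ αν) ∘ (β _ ∘ α _) ∘ N.out X Z
        ∎))
    where
    open NuMonad d'' fin'' pm''
    module N = Nu d fin
    module N' = Nu d' fin'
    module N'' = Nu d'' fin''
    βν = νMor d' fin' d'' fin'' β {X} Z
    αν = νMor d fin d' fin' α {X} Z

theorem4p3 : ∀ {o ℓ e o' ℓ' e' g : Level}
      (C : Category o ℓ e) (D : Category o' ℓ' e') (cop : Coproducts C) →
      let open Theory C D cop
          _≈_ = Category._≈_ C
          idC = Category.id C
          _∘_ = Category._∘_ C
      in
      -- #^ν is a parametrized monad C × D → C
      ((d : PMData E) (fin : Finals d) →
         IsParametrizedMonad E d →
         IsParametrizedMonad D (Nu.νd d fin))
      -- (1) guardedness is inherited
      × ((d : PMData E) (fin : Finals d) (G : GuardData E g d) →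
         IsParametrizedMonad E d → IsParametrizedGuarded E d G →
         IsParametrizedGuarded D (Nu.νd d fin) (Nu.νG d fin G))
      -- (1) α ↦ α^ν is a functor between categories of guarded parametrized monads:
      --     it sends morphisms to morphisms, ...
      × ((d : PMData E) (fin : Finals d) (G : GuardData E g d)
         (d' : PMData E) (fin' : Finals d') (G' : GuardData E g d')
         (α : MorData E d d') →
         IsParametrizedMonad E d → IsParametrizedGuarded E d G →
         IsParametrizedMonad E d' → IsParametrizedGuarded E d' G' →
         IsParametrizedGuardedMonadMorphism E d G d' G' α →
         IsParametrizedGuardedMonadMorphism D (Nu.νd d fin) (Nu.νG d fin G)
           (Nu.νd d' fin') (Nu.νG d' fin' G') (νMor d fin d' fin' α))
      --     ... preserves identities, ...
      × ((d : PMData E) (fin : Finals d) (G : GuardData E g d) →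
         IsParametrizedMonad E d → IsParametrizedGuarded E d G →
         ∀ X Z → νMor d fin d fin (idMor E d) {X} Z ≈ idC)
      --     ... and preserves composition
      × ((d : PMData E) (fin : Finals d) (G : GuardData E g d)
         (d' : PMData E) (fin' : Finals d') (G' : GuardData E g d')
         (d'' : PMData E) (fin'' : Finals d'') (G'' : GuardData E g d'')
         (α : MorData E d d') (β : MorData E d' d'') →
         IsParametrizedMonad E d → IsParametrizedGuarded E d G →
         IsParametrizedMonad E d' → IsParametrizedGuarded E d' G' →
         IsParametrizedMonad E d'' → IsParametrizedGuarded E d'' G'' →
         IsParametrizedGuardedMonadMorphism E d G d' G' α →
         IsParametrizedGuardedMonadMorphism E d' G' d'' G'' β →
         ∀ X Z → νMor d fin d'' fin'' (compMor E {d} {d'} {d''} β α) {X} Z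
                   ≈ (νMor d' fin' d'' fin'' β {X} Z ∘ νMor d fin d' fin' α {X} Z))
      -- (2) guarded pre-iterativity is inherited, with solutions f^††
      × ((d : PMData E) (fin : Finals d) (G : GuardData E g d) (dag : IterData E d G) →
         IsParametrizedMonad E d → IsGuardedPreIterative E d G dag →
         IsGuardedPreIterative D (Nu.νd d fin) (Nu.νG d fin G) (Nu.ν† d fin G dag))
      -- (3) guarded iterativity is inherited, with solutions f^††
      × ((d : PMData E) (fin : Finals d) (G : GuardData E g d) (dag : IterData E d G) →
         IsParametrizedMonad E d → IsGuardedIterative E d G dag →
         IsGuardedIterative D (Nu.νd d fin) (Nu.νG d fin G) (Nu.ν† d fin G dag))
theorem4p3 C D cop =
    (λ d fin pm → NuMonad.isParametrizedMonad d fin pm)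
  , (λ d fin G pm pg → NuMonad.Guarded.isParametrizedGuarded d fin pm G pg)
  , (λ d fin G d' fin' G' α pm pg pm' pg' αg →
       NuMorphism.Guarded.isParametrizedGuardedMonadMorphism d fin pm d' fin' pm' α
         (IsParametrizedGuardedMonadMorphism.isMorphism αg) G G' pg' αg)
  , (λ d fin G pm pg → νMor-identity d fin pm)
  , (λ d fin G d' fin' G' d'' fin'' G'' α β pm pg pm' pg' pm'' pg'' αg βg →
       νMor-∘ d fin d' fin' d'' fin'' pm'' α β
         (IsParametrizedGuardedMonadMorphism.isMorphism βg))
  , (λ d fin G dag pm pi → NuMonad.PreIterative.isGuardedPreIterative d fin pm G dag pi)
  , (λ d fin G dag pm it → NuMonad.Iterative.isGuardedIterative d fin pm G dag it)
  where
  open Construction C D cop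
  open Theory C D cop using (IsParametrizedGuardedMonadMorphism)
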